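{- Let $p=\underline{p_1p_2\cdots p_\ell}$ be a consecutive pattern with $p_1<p_\ell$ (resp. $p_1>p_\ell$). Then the extended permutation of $p$ at the index $\ell$ begins (resp. ends) with $p$, and the corresponding extended multiset is $M(k_1,k_2,\ldots,k_{\ell+|p_\ell-p_1|})$, where $k_j=2$ if $1\le j\le\min\{p_1,p_\ell\}-1$ or $\max\{p_1,p_\ell\}+1\le j\le\ell$, and $k_j=1$ otherwise.
   Context: $M(k_1,\ldots,k_n)$ is the multiset containing the letter $j$ exactly $k_j$ times. A consecutive pattern $p=\underline{p_1\cdots p_\ell}$ is a permutation $p_1\cdots p_\ell$ of $\{1,\ldots,\ell\}$; a factor $\pi_a\cdots\pi_{a+\ell-1}$ of a word over positive integers forms an occurrence of $p$ if for all $j,k$, $\pi_{a+j-1}<\pi_{a+k-1}$ iff $p_j<p_k$. An index $i$ with $2\le i\le\ell$ is extendable if there is a word $\pi=\pi_1\cdots\pi_{\ell+i-1}$ over positive integers whose first $\ell$ letters and whose last $\ell$ letters each form an occurrence of $p$ (the index $\ell$ is always extendable). Among all such words, the lexicographically minimal one (comparing $\pi_1$ first, then $\pi_2$, etc.) is the extended permutation of $p$ at $i$, and the multiset of its letters is the extended multiset of $p$ at $i$. "Begins with $p$" means its first $\ell$ letters are $p_1,\ldots,p_\ell$. -}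

module Defs where

open import Data.Nat using (ℕ; zero; suc; _+_; _∸_; _≤_; _<_; _⊓_; _⊔_; ∣_-_∣; _≟_; _≡ᵇ_; _<ᵇ_; _≤ᵇ_)
open import Data.Bool using (if_then_else_; _∨_; _∧_)
open import Data.List using (List; []; _∷_; length; map; upTo; take; drop)
open import Data.List.Relation.Unary.All using (All)
open import Data.List.Relation.Binary.Permutation.Propositional using (_↭_)
open import Data.Product using (_×_; Σ)
open import Function.Bundles using (_⇔_)
open import Relation.Nullary using (yes; no)
open import Relation.Binary.PropositionalEquality using (_≡_)

-- Safe indexing into a list of naturals (0-based); returns 0 out of range.
-- Only used at in-range indices below.
at : List ℕ → ℕ → ℕ
at []       _       = 0
at (x ∷ _)  zero    = x
at (_ ∷ xs) (suc n) = at xs n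

IsPattern : ℕ → List ℕ → Set
IsPattern ℓ p = length p ≡ ℓ × (p ↭ map suc (upTo ℓ))

Occurrence : List ℕ → List ℕ → Set
Occurrence p u =
  length u ≡ length p ×
  (∀ j k → j < length p → k < length p → (at u j < at u k) ⇔ (at p j < at p k))

Witness : List ℕ → ℕ → List ℕ → Set
Witness p i w =
  length w ≡ length p + i ∸ 1 ×
  All (1 ≤_) w ×
  Occurrence p (take (length p) w) ×
  Occurrence p (drop (i ∸ 1) w)

data LexLeq : List ℕ → List ℕ → Set where
  lex-[]   : ∀ {ys} → LexLeq [] ys
  lex-<    : ∀ {x y xs ys} → x < y → LexLeq (x ∷ xs) (y ∷ ys)
  lex-cons : ∀ {x xs ys} → LexLeq xs ys → LexLeq (x ∷ xs) (x ∷ ys)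

IsExtendedPerm : List ℕ → ℕ → List ℕ → Set
IsExtendedPerm p i w = Witness p i w × (∀ v → Witness p i v → LexLeq w v)

count : ℕ → List ℕ → ℕ
count j [] = 0
count j (x ∷ xs) with x ≟ j
... | yes _ = suc (count j xs)
... | no  _ = count j xs

-- The multiplicity function k of the multiset M(k₁,…,k_{ℓ+|pℓ-p₁|}) from the
-- statement, with a = p₁, b = p_ℓ; k j = 0 for letters j outside 1..ℓ+|b-a|.
kmult : ℕ → ℕ → ℕ → ℕ → ℕ
kmult ℓ a b j =
  if (j ≡ᵇ 0) ∨ (ℓ + ∣ b - a ∣ <ᵇ j) then 0
  else if (j <ᵇ (a ⊓ b)) ∨ (((a ⊔ b) <ᵇ j) ∧ (j ≤ᵇ ℓ)) then 2
  else 1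

module Submission where

-- Write a = p₁ and b = p_ℓ and suppose a < b.  Because p is a permutation of 1..ℓ, every
-- occurrence u of p in positive integers satisfies u_k ≥ u_j + (p_k − p_j) whenever p_j ≤ p_k.
-- In a witness v the two occurrences of p share the letter v_ℓ.  The first occurrence therefore
-- dominates p letter by letter, so v_ℓ ≥ b, and then the second one dominates σ(p), where σ
-- fixes the values below a and raises the others by b − a.  The word p σ(p₂)⋯σ(p_ℓ) is itself a
-- witness, hence the letterwise and a fortiori the lexicographic minimum.  Its letters are 1..ℓ
-- together with σ(1..ℓ) = {1..a−1} ∪ {b..ℓ+b−a} minus the shared letter b.  For a > b the shifted
-- copy σ(p), now raising the values from b on by a − b, is placed in front of p instead.

open import Defs
open import Data.Bool using (true; false)
open import Data.Nat using (ℕ; zero; suc; _+_; _∸_; _≤_; _<_; _≟_; _<?_; _<ᵇ_; z≤n; s≤s; s≤s⁻¹; z<s; s<s)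
open import Data.Nat.Properties
open import Algebra.Properties.CommutativeSemigroup +-commutativeSemigroup using (x∙yz≈y∙xz)
open import Data.List using (List; []; _∷_; [_]; _++_; length; map; take; drop; applyUpTo)
open import Data.List.Properties
  using (length-map; length-++; ++-assoc; map-++; map-applyUpTo; take++drop≡id; take-take)
open import Data.List.Membership.Propositional using (_∈_)
open import Data.List.Relation.Unary.Any using (here; there)
open import Data.List.Relation.Unary.All using (All; []; _∷_)
import Data.List.Relation.Unary.All as All
import Data.List.Relation.Unary.All.Properties as All
open import Data.List.Relation.Binary.Pointwise using (Pointwise; []; _∷_)
import Data.List.Relation.Binary.Pointwise as Pointwise
open import Data.List.Relation.Binary.Permutation.Propositional
  using (_↭_; prep; swap; ↭-sym; ↭-reflexive; module PermutationReasoning)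
  renaming (refl to ↭-refl; trans to ↭-trans)
open import Data.List.Relation.Binary.Permutation.Propositional.Properties
  using (∈-resp-↭; ++⁺; ++⁺ˡ; ++-comm; drop-∷; map⁺)
  renaming (shift to ↭-shift)
open import Data.Product using (_×_; _,_; proj₁; proj₂; ∃)
open import Data.Sum using (_⊎_; inj₁; inj₂; [_,_]′)
import Data.Sum as Sum
open import Function using (id)
open import Function.Bundles using (_⇔_; mk⇔; Equivalence)
open import Relation.Binary.Definitions using (tri<; tri≈; tri>)
open import Relation.Nullary using (yes; no; contradiction)
open import Relation.Nullary.Reflects using (ofʸ; ofⁿ)
open import Relation.Binary.PropositionalEquality
  using (_≡_; refl; sym; trans; cong; cong₂; subst; subst₂; module ≡-Reasoning)

at-map : ∀ (f : ℕ → ℕ) xs {i} → i < length xs → at (map f xs) i ≡ f (at xs i)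
at-map f (x ∷ xs) {zero}  _         = refl
at-map f (x ∷ xs) {suc i} (s≤s i<n) = at-map f xs i<n

at-take : ∀ n xs {i} → i < n → at (take n xs) i ≡ at xs i
at-take (suc n) []       _                 = refl
at-take (suc n) (x ∷ xs) {zero}  _         = refl
at-take (suc n) (x ∷ xs) {suc i} (s≤s i<n) = at-take n xs i<n

at-drop : ∀ n xs i → at (drop n xs) i ≡ at xs (n + i)
at-drop zero    xs       i = refl
at-drop (suc n) []       i = refl
at-drop (suc n) (x ∷ xs) i = at-drop n xs i

at-∈ : ∀ xs {i} → i < length xs → at xs i ∈ xs
at-∈ (x ∷ xs) {zero}  _         = here refl
at-∈ (x ∷ xs) {suc i} (s≤s i<n) = there (at-∈ xs i<n)

∈⇒at : ∀ {x xs} → x ∈ xs → ∃ λ i → i < length xs × at xs i ≡ x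
∈⇒at (here refl)  = 0 , z<s , refl
∈⇒at (there x∈xs) with i , i<n , xsᵢ≡x ← ∈⇒at x∈xs = suc i , s<s i<n , xsᵢ≡x

All-at : ∀ {P : ℕ → Set} {xs} → All P xs → ∀ {i} → i < length xs → P (at xs i)
All-at (px ∷ _)  {zero}  _         = px
All-at (_ ∷ pxs) {suc i} (s≤s i<n) = All-at pxs i<n

length-take-init : ∀ (xs : List ℕ) {n} → length xs ≡ suc n → length (take n xs) ≡ n
length-take-init (x ∷ [])     {zero}  _  = refl
length-take-init (x ∷ y ∷ xs) {suc n} eq = cong suc (length-take-init (y ∷ xs) (suc-injective eq))

take-init-++-last : ∀ (xs : List ℕ) {n} → length xs ≡ suc n → take n xs ++ [ at xs n ] ≡ xs
take-init-++-last (x ∷ [])     {zero}  _  = refl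
take-init-++-last (x ∷ y ∷ xs) {suc n} eq = cong (x ∷_) (take-init-++-last (y ∷ xs) (suc-injective eq))

take-suc-++ : ∀ (xs : List ℕ) {y ys n} → length xs ≡ n → take (suc n) (xs ++ y ∷ ys) ≡ xs ++ [ y ]
take-suc-++ []       refl = refl
take-suc-++ (x ∷ xs) refl = cong (x ∷_) (take-suc-++ xs refl)

drop-++ : ∀ (xs : List ℕ) {ys n} → length xs ≡ n → drop n (xs ++ ys) ≡ ys
drop-++ []       refl = refl
drop-++ (x ∷ xs) refl = drop-++ xs refl

at⇒Pointwise : ∀ {R : ℕ → ℕ → Set} xs ys → length xs ≡ length ys →
  (∀ {i} → i < length xs → R (at xs i) (at ys i)) → Pointwise R xs ys
at⇒Pointwise []       []       _  _  = []
at⇒Pointwise (x ∷ xs) (y ∷ ys) eq Rᵢ = Rᵢ z<s ∷ at⇒Pointwise xs ys (suc-injective eq) (λ i<n → Rᵢ (s<s i<n))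

Pointwise-take⁺ : ∀ {R : ℕ → ℕ → Set} n {xs ys} → Pointwise R xs ys → Pointwise R (take n xs) (take n ys)
Pointwise-take⁺ zero    _        = []
Pointwise-take⁺ (suc n) []       = []
Pointwise-take⁺ (suc n) (r ∷ rs) = r ∷ Pointwise-take⁺ n rs

Pointwise-≤⇒LexLeq : ∀ {xs ys} → Pointwise _≤_ xs ys → LexLeq xs ys
Pointwise-≤⇒LexLeq []         = lex-[]
Pointwise-≤⇒LexLeq (x≤y ∷ rs) with m≤n⇒m<n∨m≡n x≤y
... | inj₁ x<y  = lex-< x<y
... | inj₂ refl = lex-cons (Pointwise-≤⇒LexLeq rs)

LexLeq-antisym : ∀ {xs ys} → LexLeq xs ys → LexLeq ys xs → xs ≡ ys
LexLeq-antisym lex-[]        lex-[]        = refl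
LexLeq-antisym (lex-< x<y)   (lex-< y<x)   = contradiction y<x (<-asym x<y)
LexLeq-antisym (lex-< x<x)   (lex-cons _)  = contradiction x<x (<-irrefl refl)
LexLeq-antisym (lex-cons _)  (lex-< x<x)   = contradiction x<x (<-irrefl refl)
LexLeq-antisym (lex-cons le) (lex-cons ge) = cong (_ ∷_) (LexLeq-antisym le ge)

-- Multiplicities

count-++ : ∀ j xs ys → count j (xs ++ ys) ≡ count j xs + count j ys
count-++ j []       ys = refl
count-++ j (x ∷ xs) ys with x ≟ j
... | yes _ = cong suc (count-++ j xs ys)
... | no  _ = count-++ j xs ys

count-↭ : ∀ j {xs ys} → xs ↭ ys → count j xs ≡ count j ys
count-↭ j ↭-refl                = refl
count-↭ j (prep x xs↭ys) with x ≟ j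
... | yes _ = cong suc (count-↭ j xs↭ys)
... | no  _ = count-↭ j xs↭ys
count-↭ j (swap {xs} {ys} x y xs↭ys) = begin
  count j (x ∷ y ∷ xs)                          ≡⟨ count-++ j [ x ] (y ∷ xs) ⟩
  count j [ x ] + count j (y ∷ xs)              ≡⟨ cong (count j [ x ] +_) (count-++ j [ y ] xs) ⟩
  count j [ x ] + (count j [ y ] + count j xs)  ≡⟨ x∙yz≈y∙xz (count j [ x ]) (count j [ y ]) (count j xs) ⟩
  count j [ y ] + (count j [ x ] + count j xs)  ≡⟨ cong (λ c → count j [ y ] + (count j [ x ] + c)) (count-↭ j xs↭ys) ⟩
  count j [ y ] + (count j [ x ] + count j ys)  ≡⟨ cong (count j [ y ] +_) (count-++ j [ x ] ys) ⟨
  count j [ y ] + count j (x ∷ ys)              ≡⟨ count-++ j [ y ] (x ∷ ys) ⟨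
  count j (y ∷ x ∷ ys)                          ∎
  where open ≡-Reasoning
count-↭ j (↭-trans xs↭ys ys↭zs) = trans (count-↭ j xs↭ys) (count-↭ j ys↭zs)

interval : ℕ → ℕ → List ℕ
interval lo zero    = []
interval lo (suc n) = lo ∷ interval (suc lo) n

applyUpTo≡interval : ∀ {f : ℕ → ℕ} lo n → (∀ i → f i ≡ lo + i) → applyUpTo f n ≡ interval lo n
applyUpTo≡interval lo zero    _  = refl
applyUpTo≡interval lo (suc n) f≗ = cong₂ _∷_ (trans (f≗ 0) (+-identityʳ lo))
  (applyUpTo≡interval (suc lo) n (λ i → trans (f≗ (suc i)) (+-suc lo i)))

interval-++ : ∀ lo m n → interval lo (m + n) ≡ interval lo m ++ interval (lo + m) n
interval-++ lo zero    n = cong (λ l → interval l n) (sym (+-identityʳ lo))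
interval-++ lo (suc m) n = cong (lo ∷_) (trans (interval-++ (suc lo) m n)
  (cong (λ l → interval (suc lo) m ++ interval l n) (sym (+-suc lo m))))

∈-interval⁻ : ∀ {x} lo n → x ∈ interval lo n → lo ≤ x × x < lo + n
∈-interval⁻ lo (suc n) (here refl) = ≤-refl , m<m+n lo z<s
∈-interval⁻ {x} lo (suc n) (there x∈) with lo<x , x<hi ← ∈-interval⁻ (suc lo) n x∈ =
  <⇒≤ lo<x , subst (x <_) (sym (+-suc lo n)) x<hi

∈-interval⁺ : ∀ {x} lo n → lo ≤ x → x < lo + n → x ∈ interval lo n
∈-interval⁺ {x} lo zero    lo≤x x<hi = contradiction (subst (x <_) (+-identityʳ lo) x<hi) (≤⇒≯ lo≤x)
∈-interval⁺ {x} lo (suc n) lo≤x x<hi with lo ≟ x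
... | yes refl = here refl
... | no  lo≢x = there (∈-interval⁺ (suc lo) n (≤∧≢⇒< lo≤x lo≢x) (subst (x <_) (+-suc lo n) x<hi))

count-interval-∉ : ∀ j lo n → j < lo ⊎ lo + n ≤ j → count j (interval lo n) ≡ 0
count-interval-∉ j lo zero    _       = refl
count-interval-∉ j lo (suc n) outside with lo ≟ j
... | yes refl = contradiction outside [ <-irrefl refl , <⇒≱ (m<m+n lo z<s) ]′
... | no  _    = count-interval-∉ j (suc lo) n (Sum.map m<n⇒m<1+n (subst (_≤ j) (+-suc lo n)) outside)

count-interval-∈ : ∀ j lo n → lo ≤ j → j < lo + n → count j (interval lo n) ≡ 1
count-interval-∈ j lo zero    lo≤j j<hi = contradiction (subst (j <_) (+-identityʳ lo) j<hi) (≤⇒≯ lo≤j)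
count-interval-∈ j lo (suc n) lo≤j j<hi with lo ≟ j
... | yes refl = cong suc (count-interval-∉ j (suc lo) n (inj₁ (n<1+n lo)))
... | no  lo≢j = count-interval-∈ j (suc lo) n (≤∧≢⇒< lo≤j lo≢j) (subst (j <_) (+-suc lo n) j<hi)

-- The multiset M(k₁, …) of the statement, for m = min{p₁, p_ℓ} and M = max{p₁, p_ℓ}:
-- 1..ℓ once, plus a second copy of 1..m−1 and of M+1..ℓ, plus ℓ+1..ℓ+M−m.
extendedMultiset : ℕ → ℕ → ℕ → List ℕ
extendedMultiset ℓ m M = interval 1 ℓ ++ interval 1 (m ∸ 1) ++ interval (suc M) (ℓ ∸ m)

extendedMultiset-top : ∀ {ℓ m M} → m < M → M ≤ ℓ → suc M + (ℓ ∸ m) ≡ suc (ℓ + (M ∸ m))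
extendedMultiset-top {ℓ} {m} {M} m<M M≤ℓ = cong suc (begin
  M + (ℓ ∸ m)   ≡⟨ +-∸-assoc M (<⇒≤ (<-≤-trans m<M M≤ℓ)) ⟨
  M + ℓ ∸ m     ≡⟨ cong (_∸ m) (+-comm M ℓ) ⟩
  ℓ + M ∸ m     ≡⟨ +-∸-assoc ℓ (<⇒≤ m<M) ⟩
  ℓ + (M ∸ m)   ∎)
  where open ≡-Reasoning

kmult-comm : ∀ ℓ a b j → kmult ℓ a b j ≡ kmult ℓ b a j
kmult-comm ℓ a b j rewrite ⊓-comm a b | ⊔-comm a b | ∣-∣-comm a b = refl

count-extendedMultiset : ∀ {ℓ m M} → 1 ≤ m → m < M → M ≤ ℓ →
  ∀ j → count j (extendedMultiset ℓ m M) ≡ kmult ℓ m M j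
count-extendedMultiset {ℓ} {suc m′} {M} _ m<M M≤ℓ j
  rewrite m≤n⇒m⊓n≡m (<⇒≤ m<M) | m≤n⇒m⊔n≡n (<⇒≤ m<M) | m≤n⇒∣n-m∣≡n∸m (<⇒≤ m<M)
        | count-++ j (interval 1 ℓ) (interval 1 m′ ++ interval (suc M) (ℓ ∸ suc m′))
        | count-++ j (interval 1 m′) (interval (suc M) (ℓ ∸ suc m′))
  with j
... | zero = cong₂ _+_ (count-interval-∉ 0 1 ℓ (inj₁ z<s))
  (cong₂ _+_ (count-interval-∉ 0 1 m′ (inj₁ z<s))
             (count-interval-∉ 0 (suc M) (ℓ ∸ suc m′) (inj₁ z<s)))
... | suc j with ℓ + (M ∸ suc m′) <ᵇ suc j | <ᵇ-reflects-< (ℓ + (M ∸ suc m′)) (suc j)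
... | true  | ofʸ t<J = cong₂ _+_ (count-interval-∉ (suc j) 1 ℓ (inj₂ ℓ<J))
  (cong₂ _+_ (count-interval-∉ (suc j) 1 m′ (inj₂ (<⇒≤ (<-trans (<-≤-trans m<M M≤ℓ) ℓ<J))))
             (count-interval-∉ (suc j) (suc M) (ℓ ∸ suc m′)
                (inj₂ (subst (_≤ suc j) (sym (extendedMultiset-top m<M M≤ℓ)) t<J))))
  where ℓ<J = ≤-<-trans (m≤m+n ℓ (M ∸ suc m′)) t<J
... | false | ofⁿ t≮J with j <ᵇ m′ | <ᵇ-reflects-< (suc j) (suc m′)
... | true  | ofʸ J<m = cong₂ _+_
  (count-interval-∈ (suc j) 1 ℓ (s≤s z≤n) (s≤s (<⇒≤ (<-≤-trans J<m (≤-trans (<⇒≤ m<M) M≤ℓ)))))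
  (cong₂ _+_ (count-interval-∈ (suc j) 1 m′ (s≤s z≤n) J<m)
             (count-interval-∉ (suc j) (suc M) (ℓ ∸ suc m′) (inj₁ (<-trans J<m (m<n⇒m<1+n m<M)))))
... | false | ofⁿ J≮m with M <ᵇ suc j | <ᵇ-reflects-< M (suc j)
... | false | ofⁿ M≮J = cong₂ _+_ (count-interval-∈ (suc j) 1 ℓ (s≤s z≤n) (s≤s (≤-trans (≮⇒≥ M≮J) M≤ℓ)))
  (cong₂ _+_ (count-interval-∉ (suc j) 1 m′ (inj₂ (≮⇒≥ J≮m)))
             (count-interval-∉ (suc j) (suc M) (ℓ ∸ suc m′) (inj₁ (s≤s (≮⇒≥ M≮J)))))
... | true  | ofʸ M<J with j <ᵇ ℓ | ≤ᵇ-reflects-≤ (suc j) ℓ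
... | true  | ofʸ J≤ℓ = cong₂ _+_ (count-interval-∈ (suc j) 1 ℓ (s≤s z≤n) (s≤s J≤ℓ))
  (cong₂ _+_ (count-interval-∉ (suc j) 1 m′ (inj₂ (≮⇒≥ J≮m)))
             (count-interval-∈ (suc j) (suc M) (ℓ ∸ suc m′) M<J
                (subst (suc j <_) (sym (extendedMultiset-top m<M M≤ℓ)) (s≤s (≤-trans J≤ℓ (m≤m+n ℓ _))))))
... | false | ofⁿ J≰ℓ = cong₂ _+_ (count-interval-∉ (suc j) 1 ℓ (inj₂ (≰⇒> J≰ℓ)))
  (cong₂ _+_ (count-interval-∉ (suc j) 1 m′ (inj₂ (≮⇒≥ J≮m)))
             (count-interval-∈ (suc j) (suc M) (ℓ ∸ suc m′) M<J
                (subst (suc j <_) (sym (extendedMultiset-top m<M M≤ℓ)) (s≤s (≮⇒≥ t≮J)))))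

-- The value shift

shift : ℕ → ℕ → ℕ → ℕ
shift c e x with x <? c
... | yes _ = x
... | no  _ = x + e

shift-< : ∀ c e {x} → x < c → shift c e x ≡ x
shift-< c e {x} x<c with x <? c
... | yes _   = refl
... | no  x≮c = contradiction x<c x≮c

shift-≥ : ∀ c e {x} → c ≤ x → shift c e x ≡ x + e
shift-≥ c e {x} c≤x with x <? c
... | yes x<c = contradiction c≤x (<⇒≱ x<c)
... | no  _   = refl

shift-≤ : ∀ {c e x y} → (x < c → x ≤ y) → (c ≤ x → x + e ≤ y) → shift c e x ≤ y
shift-≤ {c} {e} {x} below above with x <? c
... | yes x<c = below x<c
... | no  x≮c = above (≮⇒≥ x≮c)

shift-inflationary : ∀ c e x → x ≤ shift c e x
shift-inflationary c e x with x <? c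
... | yes _ = ≤-refl
... | no  _ = m≤m+n x e

shift-strictMono : ∀ c e {x y} → x < y → shift c e x < shift c e y
shift-strictMono c e {x} {y} x<y with x <? c | y <? c
... | yes _   | yes _   = x<y
... | yes _   | no  _   = <-≤-trans x<y (m≤m+n y e)
... | no  x≮c | yes y<c = contradiction (<-trans x<y y<c) x≮c
... | no  _   | no  _   = +-monoˡ-< e x<y

map-shift-positive : ∀ c e {xs} → All (1 ≤_) xs → All (1 ≤_) (map (shift c e) xs)
map-shift-positive c e xs-pos = All.map⁺ (All.map (λ {x} 1≤x → ≤-trans 1≤x (shift-inflationary c e x)) xs-pos)

map-shift-interval-below : ∀ c e lo n → lo + n ≤ c → map (shift c e) (interval lo n) ≡ interval lo n
map-shift-interval-below c e lo zero    _    = refl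
map-shift-interval-below c e lo (suc n) hi≤c = cong₂ _∷_
  (shift-< c e (<-≤-trans (m<m+n lo z<s) hi≤c))
  (map-shift-interval-below c e (suc lo) n (subst (_≤ c) (+-suc lo n) hi≤c))

map-shift-interval-above : ∀ c e lo n → c ≤ lo → map (shift c e) (interval lo n) ≡ interval (lo + e) n
map-shift-interval-above c e lo zero    _    = refl
map-shift-interval-above c e lo (suc n) c≤lo = cong₂ _∷_ (shift-≥ c e c≤lo)
  (map-shift-interval-above c e (suc lo) n (m≤n⇒m≤1+n c≤lo))

map-shift-interval : ∀ c e k →
  map (shift (suc c) e) (interval 1 (c + suc k)) ≡ interval 1 c ++ (suc c + e) ∷ interval (suc (suc c + e)) k
map-shift-interval c e k = begin
  map s (interval 1 (c + suc k))                            ≡⟨ cong (map s) (interval-++ 1 c (suc k)) ⟩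
  map s (interval 1 c ++ interval (suc c) (suc k))          ≡⟨ map-++ s (interval 1 c) _ ⟩
  map s (interval 1 c) ++ map s (interval (suc c) (suc k))  ≡⟨ cong₂ _++_
                                                                 (map-shift-interval-below (suc c) e 1 c ≤-refl)
                                                                 (map-shift-interval-above (suc c) e (suc c) (suc k) ≤-refl) ⟩
  interval 1 c ++ interval (suc c + e) (suc k)              ∎
  where
  s = shift (suc c) e
  open ≡-Reasoning

-- Patterns and their occurrences

pattern↭interval : ∀ {ℓ p} → IsPattern ℓ p → p ↭ interval 1 ℓ
pattern↭interval {ℓ} (_ , p↭) =
  ↭-trans p↭ (↭-reflexive (trans (map-applyUpTo id suc ℓ) (applyUpTo≡interval 1 ℓ (λ _ → refl))))

pattern-value-bounds : ∀ {ℓ p} → IsPattern ℓ p → ∀ {i} → i < ℓ → 1 ≤ at p i × at p i ≤ ℓ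
pattern-value-bounds {ℓ} {p} pat@(lp , _) i<ℓ
  with 1≤pᵢ , pᵢ<1+ℓ ← ∈-interval⁻ 1 ℓ (∈-resp-↭ (pattern↭interval pat) (at-∈ p (subst (_ <_) (sym lp) i<ℓ)))
  = 1≤pᵢ , s≤s⁻¹ pᵢ<1+ℓ

pattern-value-position : ∀ {ℓ p} → IsPattern ℓ p → ∀ {r} → 1 ≤ r → r ≤ ℓ → ∃ λ i → i < ℓ × at p i ≡ r
pattern-value-position {ℓ} pat@(lp , _) 1≤r r≤ℓ
  with i , i<n , pᵢ≡r ← ∈⇒at (∈-resp-↭ (↭-sym (pattern↭interval pat)) (∈-interval⁺ 1 ℓ 1≤r (s≤s r≤ℓ)))
  = i , subst (i <_) lp i<n , pᵢ≡r

pattern-positive : ∀ {ℓ p} → IsPattern ℓ p → All (1 ≤_) p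
pattern-positive {ℓ} pat = All.tabulate λ x∈p → proj₁ (∈-interval⁻ 1 ℓ (∈-resp-↭ (pattern↭interval pat) x∈p))

shifted-pattern↭ : ∀ {ℓ p m M} → IsPattern ℓ p → 1 ≤ m → m ≤ M → M ≤ ℓ →
  p ++ map (shift m (M ∸ m)) p ↭ M ∷ extendedMultiset ℓ m M
shifted-pattern↭ {ℓ} {p} {suc c} {M} pat _ m≤M M≤ℓ = begin
  p ++ map s p                                          ↭⟨ ++⁺ p↭ (map⁺ s p↭) ⟩
  interval 1 ℓ ++ map s (interval 1 ℓ)                  ≡⟨ cong (λ n → interval 1 ℓ ++ map s (interval 1 n)) ℓ-split ⟨
  interval 1 ℓ ++ map s (interval 1 (c + suc k))        ≡⟨ cong (interval 1 ℓ ++_) (map-shift-interval c e k) ⟩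
  interval 1 ℓ ++ interval 1 c ++ (suc c + e) ∷ rest   ↭⟨ ++⁺ˡ (interval 1 ℓ) (↭-shift (suc c + e) (interval 1 c) rest) ⟩
  interval 1 ℓ ++ (suc c + e) ∷ interval 1 c ++ rest   ↭⟨ ↭-shift (suc c + e) (interval 1 ℓ) _ ⟩
  (suc c + e) ∷ interval 1 ℓ ++ interval 1 c ++ rest   ≡⟨ cong (λ x → x ∷ interval 1 ℓ ++ interval 1 c ++ interval (suc x) k) M-split ⟩
  M ∷ extendedMultiset ℓ (suc c) M                      ∎
  where
  open PermutationReasoning
  e = M ∸ suc c
  k = ℓ ∸ suc c
  s = shift (suc c) e
  rest = interval (suc (suc c + e)) k
  p↭ = pattern↭interval pat
  ℓ-split : c + suc k ≡ ℓ
  ℓ-split = trans (+-suc c k) (m+[n∸m]≡n (≤-trans m≤M M≤ℓ))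
  M-split : suc c + e ≡ M
  M-split = m+[n∸m]≡n m≤M

occurrence-refl : ∀ p → Occurrence p p
occurrence-refl p = refl , λ _ _ _ _ → mk⇔ id id

strictMono-reflects-< : ∀ {F : ℕ → ℕ} → (∀ {x y} → x < y → F x < F y) → ∀ {x y} → F x < F y → x < y
strictMono-reflects-< F-mono {x} {y} Fx<Fy with <-cmp x y
... | tri< x<y _    _   = x<y
... | tri≈ _   refl _   = contradiction Fx<Fy (<-irrefl refl)
... | tri> _   _    y<x = contradiction (F-mono y<x) (<-asym Fx<Fy)

occurrence-map : ∀ {F : ℕ → ℕ} → (∀ {x y} → x < y → F x < F y) → ∀ p → Occurrence p (map F p)
occurrence-map {F} F-mono p = length-map F p , λ j k j<n k<n →
  subst₂ (λ x y → (x < y) ⇔ (at p j < at p k)) (sym (at-map F p j<n)) (sym (at-map F p k<n))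
    (mk⇔ (strictMono-reflects-< F-mono) F-mono)

module OccurrenceBounds {ℓ p u} (pat : IsPattern ℓ p) (occ : Occurrence p u) (u-pos : All (1 ≤_) u) where

  private
    p-index : ∀ {i} → i < ℓ → i < length p
    p-index {i} = subst (i <_) (sym (proj₁ pat))

    u-index : ∀ {i} → i < ℓ → i < length u
    u-index {i} i<ℓ = subst (i <_) (sym (proj₁ occ)) (p-index i<ℓ)

    order : ∀ {j k} → j < ℓ → k < ℓ → (at u j < at u k) ⇔ (at p j < at p k)
    order j<ℓ k<ℓ = proj₂ occ _ _ (p-index j<ℓ) (p-index k<ℓ)

  -- Every value strictly between p_j and p_k occurs in p, and u is strictly increasing along them.
  gap : ∀ d {j k} → j < ℓ → k < ℓ → at p k ≡ d + at p j → at u j + d ≤ at u k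
  gap zero {j} {k} j<ℓ k<ℓ pₖ≡pⱼ = subst (_≤ at u k) (sym (+-identityʳ (at u j)))
    (≮⇒≥ λ uₖ<uⱼ → <-irrefl pₖ≡pⱼ (Equivalence.to (order k<ℓ j<ℓ) uₖ<uⱼ))
  gap (suc d) {j} {k} j<ℓ k<ℓ pₖ≡ = via (pattern-value-position pat 1≤v (<⇒≤ (<-≤-trans v<pₖ pₖ≤ℓ)))
    where
    v<pₖ : d + at p j < at p k
    v<pₖ = subst (d + at p j <_) (sym pₖ≡) (n<1+n (d + at p j))
    1≤v : 1 ≤ d + at p j
    1≤v = ≤-trans (proj₁ (pattern-value-bounds pat j<ℓ)) (m≤n+m (at p j) d)
    pₖ≤ℓ = proj₂ (pattern-value-bounds pat k<ℓ)
    via : (∃ λ m → m < ℓ × at p m ≡ d + at p j) → at u j + suc d ≤ at u k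
    via (m , m<ℓ , pₘ≡) = subst (_≤ at u k) (sym (+-suc (at u j) d))
      (≤-<-trans (gap d j<ℓ m<ℓ pₘ≡) (Equivalence.from (order m<ℓ k<ℓ) (subst (_< at p k) (sym pₘ≡) v<pₖ)))

  rank : ∀ {k} → k < ℓ → at p k ≤ at u k
  rank {k} k<ℓ with m , m<ℓ , pₘ≡1 ← pattern-value-position pat ≤-refl (≤-trans (s≤s z≤n) k<ℓ) = begin
    at p k                 ≡⟨ m+[n∸m]≡n 1≤pₖ ⟨
    1 + (at p k ∸ 1)       ≤⟨ +-monoˡ-≤ (at p k ∸ 1) (All-at u-pos (u-index m<ℓ)) ⟩
    at u m + (at p k ∸ 1)  ≤⟨ gap (at p k ∸ 1) m<ℓ k<ℓ (trans (sym (m∸n+n≡m 1≤pₖ)) (cong (at p k ∸ 1 +_) (sym pₘ≡1))) ⟩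
    at u k                 ∎
    where
    open ≤-Reasoning
    1≤pₖ = proj₁ (pattern-value-bounds pat k<ℓ)

  shifted-rank : ∀ {r e} → r < ℓ → at p r + e ≤ at u r → ∀ {t} → t < ℓ → shift (at p r) e (at p t) ≤ at u t
  shifted-rank {r} {e} r<ℓ pᵣ+e≤uᵣ {t} t<ℓ = shift-≤ {at p r} (λ _ → rank t<ℓ) λ pᵣ≤pₜ →
    let d   = at p t ∸ at p r
        pₜ≡ = sym (m∸n+n≡m pᵣ≤pₜ)
    in begin
      at p t + e        ≡⟨ cong (_+ e) pₜ≡ ⟩
      d + at p r + e    ≡⟨ +-assoc d (at p r) e ⟩
      d + (at p r + e)  ≤⟨ +-monoʳ-≤ d pᵣ+e≤uᵣ ⟩
      d + at u r        ≡⟨ +-comm d (at u r) ⟩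
      at u r + d        ≤⟨ gap d r<ℓ t<ℓ pₜ≡ ⟩
      at u t            ∎
    where open ≤-Reasoning

  ≤-pointwise : Pointwise _≤_ p u
  ≤-pointwise = at⇒Pointwise p u (sym (proj₁ occ)) λ i<n → rank (subst (_ <_) (proj₁ pat) i<n)

  shifted-≤-pointwise : ∀ {r e} → r < ℓ → at p r + e ≤ at u r → Pointwise _≤_ (map (shift (at p r) e) p) u
  shifted-≤-pointwise {r} {e} r<ℓ pᵣ+e≤uᵣ =
    at⇒Pointwise (map s p) u (trans (length-map s p) (sym (proj₁ occ))) λ {i} i<n →
      let i<ℓ = subst (i <_) (trans (length-map s p) (proj₁ pat)) i<n in
      subst (_≤ at u i) (sym (at-map s p (p-index i<ℓ))) (shifted-rank r<ℓ pᵣ+e≤uᵣ i<ℓ)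
    where
    s = shift (at p r) e

-- Least witnesses

record IsLeastWitness (p : List ℕ) (i : ℕ) (w : List ℕ) : Set where
  constructor _,_
  field
    witness : Witness p i w
    least   : ∀ v → Witness p i v → Pointwise _≤_ w v

least⇒extendedPerm : ∀ {p i w} → IsLeastWitness p i w → IsExtendedPerm p i w
least⇒extendedPerm (W , least) = W , λ v Wv → Pointwise-≤⇒LexLeq (least v Wv)

extendedPerm-unique : ∀ {p i w w′} → IsLeastWitness p i w → IsExtendedPerm p i w′ → w′ ≡ w
extendedPerm-unique (W , least) (W′ , minimal) =
  LexLeq-antisym (minimal _ W) (Pointwise-≤⇒LexLeq (least _ W′))

extendedPerm-characterised : ∀ {p i w} {P : List ℕ → Set} → IsLeastWitness p i w → P w →
  (∃ λ w′ → IsExtendedPerm p i w′) × (∀ w′ → IsExtendedPerm p i w′ → P w′)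
extendedPerm-characterised {P = P} least Pw =
  (_ , least⇒extendedPerm least) , λ w′ ext → subst P (sym (extendedPerm-unique least ext)) Pw

module WitnessParts {n} p {v} (lp : length p ≡ suc n) (W : Witness p (suc n) v) where

  prefix-occurrence : Occurrence p (take (suc n) v)
  prefix-occurrence = subst (λ k → Occurrence p (take k v)) lp (proj₁ (proj₂ (proj₂ W)))

  suffix-occurrence : Occurrence p (drop n v)
  suffix-occurrence = proj₂ (proj₂ (proj₂ W))

  prefix-positive : All (1 ≤_) (take (suc n) v)
  prefix-positive = All.take⁺ (suc n) (proj₁ (proj₂ W))

  suffix-positive : All (1 ≤_) (drop n v)
  suffix-positive = All.drop⁺ n (proj₁ (proj₂ W))

  shared-letter : at (take (suc n) v) n ≡ at (drop n v) 0
  shared-letter = begin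
    at (take (suc n) v) n  ≡⟨ at-take (suc n) v (n<1+n n) ⟩
    at v n                 ≡⟨ cong (at v) (+-identityʳ n) ⟨
    at v (n + 0)           ≡⟨ at-drop n v 0 ⟨
    at (drop n v) 0        ∎
    where open ≡-Reasoning

-- For f and g of length n + 1 with f_n = g_0, glue n f g is the word of length 2n + 1 whose
-- first n + 1 letters are f and whose last n + 1 letters are g.
glue : ℕ → List ℕ → List ℕ → List ℕ
glue n f g = take n f ++ g

take-glue : ∀ {n f g} → length f ≡ suc n → 0 < length g → at f n ≡ at g 0 → take (suc n) (glue n f g) ≡ f
take-glue {n} {f} {y ∷ g} lf _ fₙ≡y = begin
  take (suc n) (take n f ++ y ∷ g)  ≡⟨ take-suc-++ (take n f) (length-take-init f lf) ⟩
  take n f ++ [ y ]                 ≡⟨ cong (λ x → take n f ++ [ x ]) fₙ≡y ⟨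
  take n f ++ [ at f n ]            ≡⟨ take-init-++-last f lf ⟩
  f                                 ∎
  where open ≡-Reasoning

drop-glue : ∀ {n f} g → length f ≡ suc n → drop n (glue n f g) ≡ g
drop-glue {n} {f} g lf = drop-++ (take n f) (length-take-init f lf)

glue-↭ : ∀ {n f} g → length f ≡ suc n → at f n ∷ glue n f g ↭ f ++ g
glue-↭ {n} {f} g lf = begin
  at f n ∷ take n f ++ g         ↭⟨ ↭-shift (at f n) (take n f) g ⟨
  take n f ++ [ at f n ] ++ g    ≡⟨ ++-assoc (take n f) [ at f n ] g ⟨
  (take n f ++ [ at f n ]) ++ g  ≡⟨ cong (_++ g) (take-init-++-last f lf) ⟩
  f ++ g                         ∎
  where open PermutationReasoning

glue-least : ∀ {n f g v} → Pointwise _≤_ f (take (suc n) v) → Pointwise _≤_ g (drop n v) →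
  Pointwise _≤_ (glue n f g) v
glue-least {n} {f} {g} {v} f≤ g≤ = subst (Pointwise _≤_ (glue n f g)) (take++drop≡id n v)
  (Pointwise.++⁺ (subst (Pointwise _≤_ (take n f)) take-prefix (Pointwise-take⁺ n f≤)) g≤)
  where
  take-prefix : take n (take (suc n) v) ≡ take n v
  take-prefix = trans (take-take n (suc n) v) (cong (λ k → take k v) (m≤n⇒m⊓n≡m (n≤1+n n)))

glue-witness : ∀ {n} p {f g} → length p ≡ suc n → Occurrence p f → Occurrence p g → at f n ≡ at g 0 →
  All (1 ≤_) f → All (1 ≤_) g → Witness p (suc n) (glue n f g)
glue-witness {n} p {f} {g} lp occ-f occ-g fₙ≡g₀ f-pos g-pos =
  length-glue , All.++⁺ (All.take⁺ n f-pos) g-pos , prefix , suffix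
  where
  lf = trans (proj₁ occ-f) lp
  lg = trans (proj₁ occ-g) lp
  length-glue : length (glue n f g) ≡ length p + suc n ∸ 1
  length-glue = begin
    length (take n f ++ g)        ≡⟨ length-++ (take n f) ⟩
    length (take n f) + length g  ≡⟨ cong₂ _+_ (length-take-init f lf) lg ⟩
    suc n + suc n ∸ 1             ≡⟨ cong (λ l → l + suc n ∸ 1) lp ⟨
    length p + suc n ∸ 1          ∎
    where open ≡-Reasoning
  prefix : Occurrence p (take (length p) (glue n f g))
  prefix = subst (λ k → Occurrence p (take k (glue n f g))) (sym lp)
    (subst (Occurrence p) (sym (take-glue lf (subst (0 <_) (sym lg) z<s) fₙ≡g₀)) occ-f)
  suffix : Occurrence p (drop n (glue n f g))
  suffix = subst (Occurrence p) (sym (drop-glue g lf)) occ-g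

-- The two extended permutations

module Ascending {n p} (pat : IsPattern (suc n) p) (a<b : at p 0 < at p n) where

  private
    a = at p 0
    b = at p n
    s = shift a (b ∸ a)
    lp = proj₁ pat
    1≤a = proj₁ (pattern-value-bounds pat z<s)
    b≤ℓ = proj₂ (pattern-value-bounds pat (n<1+n n))

    a+[b∸a]≡b : a + (b ∸ a) ≡ b
    a+[b∸a]≡b = m+[n∸m]≡n (<⇒≤ a<b)

    shared : at p n ≡ at (map s p) 0
    shared = sym (trans (at-map s p (subst (0 <_) (sym lp) z<s)) (trans (shift-≥ a (b ∸ a) ≤-refl) a+[b∸a]≡b))

    lower-bound : ∀ v → Witness p (suc n) v → Pointwise _≤_ (glue n p (map s p)) v
    lower-bound v W = glue-least (≤-pointwise pat prefix-occurrence prefix-positive)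
                                 (shifted-≤-pointwise pat suffix-occurrence suffix-positive z<s bound)
      where
      open WitnessParts p lp W
      open OccurrenceBounds
      bound : a + (b ∸ a) ≤ at (drop n v) 0
      bound = begin
        a + (b ∸ a)            ≡⟨ a+[b∸a]≡b ⟩
        b                      ≤⟨ rank pat prefix-occurrence prefix-positive (n<1+n n) ⟩
        at (take (suc n) v) n  ≡⟨ shared-letter ⟩
        at (drop n v) 0        ∎
        where open ≤-Reasoning

  extension : List ℕ
  extension = glue n p (map s p)

  least : IsLeastWitness p (suc n) extension
  least = glue-witness p lp (occurrence-refl p) (occurrence-map (shift-strictMono a (b ∸ a)) p) shared
                       (pattern-positive pat) (map-shift-positive a (b ∸ a) (pattern-positive pat))
        , lower-bound

  begins : take (suc n) extension ≡ p
  begins = take-glue lp (subst (0 <_) (sym (trans (length-map s p) lp)) z<s) shared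

  counts : ∀ j → count j extension ≡ kmult (suc n) a b j
  counts j = trans (count-↭ j multiset) (count-extendedMultiset 1≤a a<b b≤ℓ j)
    where
    open PermutationReasoning
    multiset : extension ↭ extendedMultiset (suc n) a b
    multiset = drop-∷ (begin
      b ∷ extension                     ↭⟨ glue-↭ (map s p) lp ⟩
      p ++ map s p                      ↭⟨ shifted-pattern↭ pat 1≤a (<⇒≤ a<b) b≤ℓ ⟩
      b ∷ extendedMultiset (suc n) a b  ∎)

module Descending {n p} (pat : IsPattern (suc n) p) (b<a : at p n < at p 0) where

  private
    a = at p 0
    b = at p n
    s = shift b (a ∸ b)
    lp = proj₁ pat
    ls = trans (length-map s p) lp
    1≤b = proj₁ (pattern-value-bounds pat (n<1+n n))
    a≤ℓ = proj₂ (pattern-value-bounds pat z<s)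

    b+[a∸b]≡a : b + (a ∸ b) ≡ a
    b+[a∸b]≡a = m+[n∸m]≡n (<⇒≤ b<a)

    shared : at (map s p) n ≡ at p 0
    shared = trans (at-map s p (subst (n <_) (sym lp) (n<1+n n))) (trans (shift-≥ b (a ∸ b) ≤-refl) b+[a∸b]≡a)

    lower-bound : ∀ v → Witness p (suc n) v → Pointwise _≤_ (glue n (map s p) p) v
    lower-bound v W = glue-least (shifted-≤-pointwise pat prefix-occurrence prefix-positive (n<1+n n) bound)
                                 (≤-pointwise pat suffix-occurrence suffix-positive)
      where
      open WitnessParts p lp W
      open OccurrenceBounds
      bound : b + (a ∸ b) ≤ at (take (suc n) v) n
      bound = begin
        b + (a ∸ b)            ≡⟨ b+[a∸b]≡a ⟩
        a                      ≤⟨ rank pat suffix-occurrence suffix-positive z<s ⟩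
        at (drop n v) 0        ≡⟨ shared-letter ⟨
        at (take (suc n) v) n  ∎
        where open ≤-Reasoning

  extension : List ℕ
  extension = glue n (map s p) p

  least : IsLeastWitness p (suc n) extension
  least = glue-witness p lp (occurrence-map (shift-strictMono b (a ∸ b)) p) (occurrence-refl p) shared
                       (map-shift-positive b (a ∸ b) (pattern-positive pat)) (pattern-positive pat)
        , lower-bound

  ends : drop n extension ≡ p
  ends = drop-glue p ls

  counts : ∀ j → count j extension ≡ kmult (suc n) a b j
  counts j = trans (count-↭ j multiset) (trans (count-extendedMultiset 1≤b b<a a≤ℓ j) (kmult-comm (suc n) b a j))
    where
    open PermutationReasoning
    multiset : extension ↭ extendedMultiset (suc n) b a
    multiset = drop-∷ (begin
      a ∷ extension                     ≡⟨ cong (_∷ extension) shared ⟨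
      at (map s p) n ∷ extension        ↭⟨ glue-↭ p ls ⟩
      map s p ++ p                      ↭⟨ ++-comm (map s p) p ⟩
      p ++ map s p                      ↭⟨ shifted-pattern↭ pat 1≤b (<⇒≤ b<a) a≤ℓ ⟩
      a ∷ extendedMultiset (suc n) b a  ∎)

corollary4p9 : (ℓ : ℕ) (p : List ℕ) → IsPattern ℓ p →
    (at p 0 < at p (ℓ ∸ 1)) ⊎ (at p (ℓ ∸ 1) < at p 0) →
    (∃ λ w → IsExtendedPerm p ℓ w) ×
    (∀ w → IsExtendedPerm p ℓ w →
      ((at p 0 < at p (ℓ ∸ 1)) → take ℓ w ≡ p) ×
      ((at p (ℓ ∸ 1) < at p 0) → drop (ℓ ∸ 1) w ≡ p) ×
      (∀ j → count j w ≡ kmult ℓ (at p 0) (at p (ℓ ∸ 1)) j))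
corollary4p9 zero          _ _   a≶b        = contradiction a≶b [ <-irrefl refl , <-irrefl refl ]′
corollary4p9 (suc zero)    _ _   a≶b        = contradiction a≶b [ <-irrefl refl , <-irrefl refl ]′
corollary4p9 (suc (suc n)) p pat (inj₁ a<b) = extendedPerm-characterised least
  ((λ _ → begins) , (λ b<a → contradiction b<a (<-asym a<b)) , counts)
  where open Ascending pat a<b
corollary4p9 (suc (suc n)) p pat (inj₂ b<a) = extendedPerm-characterised least
  ((λ a<b → contradiction a<b (<-asym b<a)) , (λ _ → ends) , counts)
  where open Descending pat b<a
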